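{- Let $S$ be a $(v,k,\mu)$ sum set in a finite group $G$ of order $v$, let $n = k^2 - \mu v$, and suppose $G$ has a normal subgroup $N$ of index $3$. If the three numbers $|S \cap C|$, as $C$ ranges over the three cosets of $N$ in $G$, are pairwise distinct, then $3$ divides $k$, $|S \cap N| = k/3$, and $n = -3x^2$ for some nonzero integer $x$.
   Context: For $a \in G$, the number of ways to write $a$ as a product in $S$ is the number of ordered pairs $(x,y) \in S\times S$ with $xy = a$. $S$ with $|S|=k$ is a $(v,k,\mu)$ sum set if every nonidentity element of $G$ can be written as a product in $S$ in exactly $\mu$ ways. -}

module Defs where

open import Level using (0ℓ)
open import Data.Nat using (ℕ; suc)
open import Data.Fin using (Fin)
open import Data.Fin.Properties using (_≟_)
open import Data.Fin.Subset using (Subset; _∈_; _∉_; _∩_; ∣_∣)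
open import Data.Fin.Subset.Properties using (_∈?_)
open import Data.List using (List; length; filter; cartesianProduct; allFin)
open import Data.Product using (_×_; _,_)
open import Data.Vec using (tabulate)
open import Relation.Nullary using (¬_; does)
open import Relation.Nullary.Decidable using (_×-dec_)
open import Relation.Binary.PropositionalEquality using (_≡_)
open import Algebra.Structures using (IsGroup)

-- A finite group of order v, represented with carrier Fin v
-- (every finite group of order v is isomorphic to one of this form).
record FinGroup (v : ℕ) : Set where
  field
    _∙_     : Fin v → Fin v → Fin v
    ε       : Fin v
    _⁻¹     : Fin v → Fin v
    isGroup : IsGroup {A = Fin v} _≡_ _∙_ ε _⁻¹
  infixl 7 _∙_
  infix 8 _⁻¹

module _ {v : ℕ} (G : FinGroup v) where
  open FinGroup G

  reps : Subset v → Fin v → ℕ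
  reps S a = length (filter (λ p → let (x , y) = p in
                               (x ∈? S) ×-dec ((y ∈? S) ×-dec ((x ∙ y) ≟ a)))
                            (cartesianProduct (allFin v) (allFin v)))

  IsSumSet : Subset v → ℕ → ℕ → Set
  IsSumSet S k μ = ∣ S ∣ ≡ k × (∀ a → ¬ (a ≡ ε) → reps S a ≡ μ)

  IsNormalSubgroup : Subset v → Set
  IsNormalSubgroup N =
    ε ∈ N ×
    (∀ x y → x ∈ N → y ∈ N → (x ∙ y) ∈ N) ×
    (∀ x → x ∈ N → (x ⁻¹) ∈ N) ×
    (∀ g x → x ∈ N → (g ∙ x ∙ g ⁻¹) ∈ N)

  coset : Fin v → Subset v → Subset v
  coset g N = tabulate (λ y → does ((g ⁻¹ ∙ y) ∈? N))

-- Two cosets of N have only 2∣N∣ < v elements, so there are three distinct cosets N, gN, hN, which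
-- together have 3∣N∣ = v elements and hence exhaust G; the class map G → ℤ/3ℤ is then a homomorphism.
-- Write a, b, c for the sizes of S ∩ N, S ∩ gN, S ∩ hN.
-- Counting the pairs (x , y) ∈ S × S with x y in a nonidentity coset in two ways gives
-- 2ab + c² = μ ∣N∣ = 2ac + b², hence (b − c)(2a − b − c) = 0. As b ≠ c this forces b + c = 2a,
-- so k = a + b + c = 3a, and k² − μ v = 9a² − 3(2ab + c²) = −3(a − c)², where a − c ≠ 0 since b ≠ c.
module Submission where

open import Defs
open import Level using (0ℓ)
open import Algebra.Bundles using (Group)
open import Algebra.Core using (Op₂)
open import Data.Bool using (true; false; if_then_else_)
open import Data.Fin using (Fin; zero; suc; toℕ)
open import Data.Fin.Patterns using (0F; 1F; 2F)
open import Data.Fin.Permutation using (permutation)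
open import Data.Fin.Properties using (_≟_; ¬∀⟶∃¬)
open import Data.Fin.Subset using (Subset; _∈_; _∉_; _∩_; ∣_∣; inside; outside)
open import Data.Fin.Subset.Properties using (_∈?_; x∈p∩q⁺; x∈p∩q⁻; x∈p⇒∣p-x∣<∣p∣)
open import Data.Integer as ℤ using (ℤ; +_; -_; _-_)
open import Data.Integer.Properties using (pos-+; pos-*; +-injective; i*j≡0⇒i≡0∨j≡0; i-j≡0⇒i≡j; i≡j⇒i-j≡0)
  renaming (+-identityʳ to ℤ-+-identityʳ)
import Data.Integer.Tactic.RingSolver as ℤ-Solver
open import Data.List using (length; filter; cartesianProduct; tabulate; map)
open import Data.List.Properties using (length-++; filter-++; map-tabulate)
open import Data.Nat using (ℕ; zero; suc; _+_; _*_; _≤_; _/_; z≤n; s≤s; NonZero; >-nonZero)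
open import Data.Nat.DivMod using (_mod_; m*n/n≡m)
open import Data.Nat.Divisibility using (_∣_; divides)
open import Data.Nat.Properties hiding (_≟_)
open import Data.Nat.Tactic.RingSolver using (solve-∀)
open import Data.Vec using ([]; _∷_) renaming (tabulate to tabulateᵛ)
open import Data.Product using (_×_; _,_; proj₁; proj₂; Σ; ∃-syntax)
open import Data.Sum using (_⊎_; inj₁; inj₂; [_,_]′)
open import Function.Base using (id; _∘_)
open import Function.Bundles using (_⇔_; mk⇔)
open import Relation.Binary.Definitions using (Decidable)
open import Relation.Binary.PropositionalEquality
open import Relation.Nullary using (Dec; does; yes; no; ¬_; contradiction)
open import Relation.Nullary.Decidable using (_×-dec_; _⊎-dec_; does-⇔)
open import Relation.Unary using (Pred)
import Relation.Unary as U

open import Algebra.Properties.Semiring.Sum +-*-semiring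
  using (sum-syntax; sum-cong-≗; ∑-comm; ∑-distrib-+; sum-permute; *-distribˡ-sum; *-distribʳ-sum)

𝟙 : {A : Set} → Dec A → ℕ
𝟙 a? = if does a? then 1 else 0

𝟙-⇔ : {A B : Set} → A ⇔ B → (a? : Dec A) (b? : Dec B) → 𝟙 a? ≡ 𝟙 b?
𝟙-⇔ A⇔B a? b? = cong (if_then 1 else 0) (does-⇔ A⇔B a? b?)

𝟙-× : {A B : Set} (a? : Dec A) (b? : Dec B) → 𝟙 (a? ×-dec b?) ≡ 𝟙 a? * 𝟙 b?
𝟙-× (yes _) (yes _) = refl
𝟙-× (yes _) (no _)  = refl
𝟙-× (no _)  _       = refl

𝟙-⊎ : {A B : Set} (a? : Dec A) (b? : Dec B) → A ⊎ B → 1 ≤ 𝟙 a? + 𝟙 b?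
𝟙-⊎ (yes _) _       _        = s≤s z≤n
𝟙-⊎ (no _)  (yes _) _        = s≤s z≤n
𝟙-⊎ (no ¬a) (no _)  (inj₁ a) = contradiction a ¬a
𝟙-⊎ (no _)  (no ¬b) (inj₂ b) = contradiction b ¬b

𝟙-disjoint₃ : {A B C : Set} (a? : Dec A) (b? : Dec B) (c? : Dec C) →
              (A → ¬ B) → (A → ¬ C) → (B → ¬ C) → 𝟙 a? + (𝟙 b? + 𝟙 c?) ≤ 1
𝟙-disjoint₃ (yes a) (yes b) _       a#b _   _   = contradiction b (a#b a)
𝟙-disjoint₃ (yes a) (no _)  (yes c) _   a#c _   = contradiction c (a#c a)
𝟙-disjoint₃ (no _)  (yes b) (yes c) _   _   b#c = contradiction c (b#c b)
𝟙-disjoint₃ (yes _) (no _)  (no _)  _   _   _   = ≤-refl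
𝟙-disjoint₃ (no _)  (yes _) (no _)  _   _   _   = ≤-refl
𝟙-disjoint₃ (no _)  (no _)  (yes _) _   _   _   = ≤-refl
𝟙-disjoint₃ (no _)  (no _)  (no _)  _   _   _   = z≤n

𝟙₃≡1⇒⊎ : {A B C : Set} (a? : Dec A) (b? : Dec B) (c? : Dec C) →
         𝟙 a? + (𝟙 b? + 𝟙 c?) ≡ 1 → A ⊎ B ⊎ C
𝟙₃≡1⇒⊎ (yes a) _       _       _ = inj₁ a
𝟙₃≡1⇒⊎ (no _)  (yes b) _       _ = inj₂ (inj₁ b)
𝟙₃≡1⇒⊎ (no _)  (no _)  (yes c) _ = inj₂ (inj₂ c)
𝟙₃≡1⇒⊎ (no _)  (no _)  (no _)  ()

∑-const-1 : ∀ n → ∑[ i < n ] 1 ≡ n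
∑-const-1 zero    = refl
∑-const-1 (suc n) = cong suc (∑-const-1 n)

∑-zero : ∀ n → ∑[ i < n ] 0 ≡ 0
∑-zero zero    = refl
∑-zero (suc n) = ∑-zero n

∑-delta : ∀ {n} (j : Fin n) (f : Fin n → ℕ) → ∑[ i < n ] (𝟙 (j ≟ i) * f i) ≡ f j
∑-delta {suc n} zero    f = trans (cong₂ _+_ (+-identityʳ (f zero)) (∑-zero n)) (+-identityʳ (f zero))
∑-delta {suc n} (suc j) f = ∑-delta j (λ i → f (suc i))

∑-mono-≤ : ∀ {n} {f g : Fin n → ℕ} → (∀ i → f i ≤ g i) → ∑[ i < n ] f i ≤ ∑[ i < n ] g i
∑-mono-≤ {zero}  f≤g = z≤n
∑-mono-≤ {suc n} f≤g = +-mono-≤ (f≤g zero) (∑-mono-≤ (λ i → f≤g (suc i)))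

∑-mono-≤-tight : ∀ {n} {f g : Fin n → ℕ} → (∀ i → f i ≤ g i) →
                 ∑[ i < n ] f i ≡ ∑[ i < n ] g i → ∀ i → f i ≡ g i
∑-mono-≤-tight {suc n} {f} {g} f≤g ∑f≡∑g i with m≤n⇒m<n∨m≡n (f≤g zero)
... | inj₁ f₀<g₀ = contradiction ∑f≡∑g (<⇒≢ (+-mono-<-≤ f₀<g₀ (∑-mono-≤ (λ i → f≤g (suc i)))))
... | inj₂ f₀≡g₀ with i
...   | zero  = f₀≡g₀
...   | suc i = ∑-mono-≤-tight (λ i → f≤g (suc i))
                  (+-cancelˡ-≡ (f zero) _ _ (trans ∑f≡∑g (cong (_+ _) (sym f₀≡g₀)))) i

∑-*𝟙-const : ∀ {n} {P : Pred (Fin n) 0ℓ} (P? : U.Decidable P) (f : Fin n → ℕ) {c} →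
             (∀ i → P i → f i ≡ c) → ∑[ i < n ] (f i * 𝟙 (P? i)) ≡ c * ∑[ i < n ] 𝟙 (P? i)
∑-*𝟙-const {n} P? f {c} f≡c = trans (sum-cong-≗ pointwise) (sym (*-distribˡ-sum c (λ i → 𝟙 (P? i))))
  where
  pointwise : ∀ i → f i * 𝟙 (P? i) ≡ c * 𝟙 (P? i)
  pointwise i with P? i
  ... | yes Pi = cong (_* 1) (f≡c i Pi)
  ... | no _   = trans (*-zeroʳ (f i)) (sym (*-zeroʳ c))

fibre-weight : ∀ {n q} → (Fin n → Fin q) → (Fin n → ℕ) → Fin q → ℕ
fibre-weight {n} φ w i = ∑[ x < n ] (w x * 𝟙 (φ x ≟ i))

∑-by-fibres : ∀ {n q} (φ : Fin n → Fin q) (w : Fin n → ℕ) (F : Fin q → ℕ) →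
              ∑[ x < n ] (w x * F (φ x)) ≡ ∑[ i < q ] (fibre-weight φ w i * F i)
∑-by-fibres {n} {q} φ w F = sym (begin
  ∑[ i < q ] (∑[ x < n ] (w x * 𝟙 (φ x ≟ i)) * F i)
    ≡⟨ sum-cong-≗ (λ i → *-distribʳ-sum (F i) (λ x → w x * 𝟙 (φ x ≟ i))) ⟩
  ∑[ i < q ] ∑[ x < n ] (w x * 𝟙 (φ x ≟ i) * F i)
    ≡⟨ ∑-comm (λ i x → w x * 𝟙 (φ x ≟ i) * F i) ⟩
  ∑[ x < n ] ∑[ i < q ] (w x * 𝟙 (φ x ≟ i) * F i)
    ≡⟨ sum-cong-≗ (λ x → sum-cong-≗ (λ i → *-assoc (w x) (𝟙 (φ x ≟ i)) (F i))) ⟩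
  ∑[ x < n ] ∑[ i < q ] (w x * (𝟙 (φ x ≟ i) * F i))
    ≡⟨ sum-cong-≗ (λ x → *-distribˡ-sum (w x) (λ i → 𝟙 (φ x ≟ i) * F i)) ⟨
  ∑[ x < n ] (w x * ∑[ i < q ] (𝟙 (φ x ≟ i) * F i))
    ≡⟨ sum-cong-≗ (λ x → cong (w x *_) (∑-delta (φ x) F)) ⟩
  ∑[ x < n ] (w x * F (φ x)) ∎)
  where open ≡-Reasoning

∑-fibre-weight : ∀ {n q} (φ : Fin n → Fin q) (w : Fin n → ℕ) →
                 ∑[ x < n ] w x ≡ ∑[ i < q ] fibre-weight φ w i
∑-fibre-weight φ w = trans (sum-cong-≗ (λ x → sym (*-identityʳ (w x))))
  (trans (∑-by-fibres φ w (λ _ → 1)) (sum-cong-≗ (λ i → *-identityʳ (fibre-weight φ w i))))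

∑∑-by-fibres : ∀ {m n q} (φ : Fin m → Fin n → Fin q) (w : Fin m → Fin n → ℕ) (F : Fin q → ℕ) →
               ∑[ x < m ] ∑[ y < n ] (w x y * F (φ x y))
               ≡ ∑[ i < q ] (∑[ x < m ] fibre-weight (φ x) (w x) i * F i)
∑∑-by-fibres {m} {n} {q} φ w F = begin
  ∑[ x < m ] ∑[ y < n ] (w x y * F (φ x y))
    ≡⟨ sum-cong-≗ (λ x → ∑-by-fibres (φ x) (w x) F) ⟩
  ∑[ x < m ] ∑[ i < q ] (fibre-weight (φ x) (w x) i * F i)
    ≡⟨ ∑-comm (λ x i → fibre-weight (φ x) (w x) i * F i) ⟩
  ∑[ i < q ] ∑[ x < m ] (fibre-weight (φ x) (w x) i * F i)
    ≡⟨ sum-cong-≗ (λ i → *-distribʳ-sum (F i) (λ x → fibre-weight (φ x) (w x) i)) ⟨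
  ∑[ i < q ] (∑[ x < m ] fibre-weight (φ x) (w x) i * F i) ∎
  where open ≡-Reasoning

∑∑-by-fibres-× : ∀ {n q} (φ : Fin n → Fin q) (w : Fin n → ℕ) (F : Fin q → Fin q → ℕ) →
                 ∑[ x < n ] ∑[ y < n ] (w x * w y * F (φ x) (φ y))
                 ≡ ∑[ i < q ] ∑[ j < q ] (fibre-weight φ w i * fibre-weight φ w j * F i j)
∑∑-by-fibres-× {n} {q} φ w F = begin
  ∑[ x < n ] ∑[ y < n ] (w x * w y * F (φ x) (φ y))
    ≡⟨ sum-cong-≗ (λ x → trans (sum-cong-≗ (λ y → *-assoc (w x) (w y) (F (φ x) (φ y))))
                               (sym (*-distribˡ-sum (w x) (λ y → w y * F (φ x) (φ y))))) ⟩
  ∑[ x < n ] (w x * ∑[ y < n ] (w y * F (φ x) (φ y)))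
    ≡⟨ sum-cong-≗ (λ x → cong (w x *_) (∑-by-fibres φ w (F (φ x)))) ⟩
  ∑[ x < n ] (w x * ∑[ j < q ] (W j * F (φ x) j))
    ≡⟨ ∑-by-fibres φ w (λ i → ∑[ j < q ] (W j * F i j)) ⟩
  ∑[ i < q ] (W i * ∑[ j < q ] (W j * F i j))
    ≡⟨ sum-cong-≗ (λ i → trans (*-distribˡ-sum (W i) (λ j → W j * F i j))
                               (sum-cong-≗ (λ j → sym (*-assoc (W i) (W j) (F i j))))) ⟩
  ∑[ i < q ] ∑[ j < q ] (W i * W j * F i j) ∎
  where
  open ≡-Reasoning
  W : Fin q → ℕ
  W = fibre-weight φ w

∣p∣≡∑𝟙 : ∀ {n} (p : Subset n) → ∣ p ∣ ≡ ∑[ x < n ] 𝟙 (x ∈? p)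
∣p∣≡∑𝟙 []            = refl
∣p∣≡∑𝟙 (inside ∷ p)  = cong suc (∣p∣≡∑𝟙 p)
∣p∣≡∑𝟙 (outside ∷ p) = ∣p∣≡∑𝟙 p

∣p∩q∣≡∑𝟙*𝟙 : ∀ {n} (p q : Subset n) → ∣ p ∩ q ∣ ≡ ∑[ x < n ] (𝟙 (x ∈? p) * 𝟙 (x ∈? q))
∣p∩q∣≡∑𝟙*𝟙 p q = trans (∣p∣≡∑𝟙 (p ∩ q)) (sum-cong-≗ λ x →
  trans (𝟙-⇔ (mk⇔ (x∈p∩q⁻ p q) (x∈p∩q⁺)) (x ∈? p ∩ q) ((x ∈? p) ×-dec (x ∈? q)))
        (𝟙-× (x ∈? p) (x ∈? q)))

𝟙-∈-tabulate : ∀ {n} {P : Pred (Fin n) 0ℓ} (P? : U.Decidable P) x →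
               𝟙 (x ∈? tabulateᵛ (λ y → does (P? y))) ≡ 𝟙 (P? x)
𝟙-∈-tabulate {suc n} P? zero with P? zero
... | yes _ = refl
... | no _  = refl
𝟙-∈-tabulate {suc n} P? (suc x) = 𝟙-∈-tabulate (λ y → P? (suc y)) x

length-filter-tabulate : ∀ {A : Set} {P : Pred A 0ℓ} (P? : U.Decidable P) {n} (f : Fin n → A) →
                         length (filter P? (tabulate f)) ≡ ∑[ i < n ] 𝟙 (P? (f i))
length-filter-tabulate P? {zero}  f = refl
length-filter-tabulate P? {suc n} f with does (P? (f zero))
... | true  = cong suc (length-filter-tabulate P? (λ i → f (suc i)))
... | false = length-filter-tabulate P? (λ i → f (suc i))

length-filter-cartesianProduct :
  ∀ {A B : Set} {P : Pred (A × B) 0ℓ} (P? : U.Decidable P) {m n} (f : Fin m → A) (g : Fin n → B) →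
  length (filter P? (cartesianProduct (tabulate f) (tabulate g))) ≡ ∑[ i < m ] ∑[ j < n ] 𝟙 (P? (f i , g j))
length-filter-cartesianProduct P? {zero}  f g = refl
length-filter-cartesianProduct P? {suc m} f g =
  trans (cong length (filter-++ P? (map (f zero ,_) (tabulate g)) _))
  (trans (length-++ (filter P? (map (f zero ,_) (tabulate g))))
         (cong₂ _+_ (trans (cong (λ xs → length (filter P? xs)) (map-tabulate g (f zero ,_)))
                           (length-filter-tabulate P? (λ j → f zero , g j)))
                    (length-filter-cartesianProduct P? (λ i → f (suc i)) g)))

module _ {v : ℕ} (G : FinGroup v) (S : Subset v) where
  open FinGroup G

  reps≡∑∑ : ∀ a → reps G S a ≡ ∑[ x < v ] ∑[ y < v ] (𝟙 (x ∈? S) * 𝟙 (y ∈? S) * 𝟙 (x ∙ y ≟ a))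
  reps≡∑∑ a = trans (length-filter-cartesianProduct pair? id id) (sum-cong-≗ λ x → sum-cong-≗ λ y →
    trans (𝟙-× (x ∈? S) ((y ∈? S) ×-dec (x ∙ y ≟ a)))
   (trans (cong (𝟙 (x ∈? S) *_) (𝟙-× (y ∈? S) (x ∙ y ≟ a)))
          (sym (*-assoc (𝟙 (x ∈? S)) (𝟙 (y ∈? S)) (𝟙 (x ∙ y ≟ a))))))
    where
    pair? : U.Decidable (λ p → proj₁ p ∈ S × proj₂ p ∈ S × proj₁ p ∙ proj₂ p ≡ a)
    pair? p = (proj₁ p ∈? S) ×-dec ((proj₂ p ∈? S) ×-dec (proj₁ p ∙ proj₂ p ≟ a))

  ∑-reps-weighted : (F : Fin v → ℕ) →
            ∑[ a < v ] (reps G S a * F a) ≡ ∑[ x < v ] ∑[ y < v ] (𝟙 (x ∈? S) * 𝟙 (y ∈? S) * F (x ∙ y))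
  ∑-reps-weighted F = sym (trans (∑∑-by-fibres _∙_ (λ x y → 𝟙 (x ∈? S) * 𝟙 (y ∈? S)) F)
                         (sum-cong-≗ λ a → cong (_* F a) (sym (reps≡∑∑ a))))

  ∣S∩fibre∣ : ∀ {q} → (Fin v → Fin q) → Fin q → ℕ
  ∣S∩fibre∣ φ = fibre-weight φ (λ x → 𝟙 (x ∈? S))

  reps-over-fibre : ∀ {q} (φ : Fin v → Fin q) (_·_ : Op₂ (Fin q)) → (∀ x y → φ (x ∙ y) ≡ φ x · φ y) →
                  ∀ t → ∑[ a < v ] (reps G S a * 𝟙 (φ a ≟ t))
                        ≡ ∑[ i < q ] ∑[ j < q ] (∣S∩fibre∣ φ i * ∣S∩fibre∣ φ j * 𝟙 (i · j ≟ t))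
  reps-over-fibre {q} φ _·_ φ-hom t = begin
    ∑[ a < v ] (reps G S a * 𝟙 (φ a ≟ t))
      ≡⟨ ∑-reps-weighted (λ a → 𝟙 (φ a ≟ t)) ⟩
    ∑[ x < v ] ∑[ y < v ] (s x * s y * 𝟙 (φ (x ∙ y) ≟ t))
      ≡⟨ sum-cong-≗ (λ x → sum-cong-≗ (λ y → cong (λ z → s x * s y * 𝟙 (z ≟ t)) (φ-hom x y))) ⟩
    ∑[ x < v ] ∑[ y < v ] (s x * s y * 𝟙 (φ x · φ y ≟ t))
      ≡⟨ ∑∑-by-fibres-× φ s (λ i j → 𝟙 (i · j ≟ t)) ⟩
    ∑[ i < q ] ∑[ j < q ] (∣S∩fibre∣ φ i * ∣S∩fibre∣ φ j * 𝟙 (i · j ≟ t)) ∎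
    where
    open ≡-Reasoning
    s : Fin v → ℕ
    s x = 𝟙 (x ∈? S)

infixl 6 _+₃_

_+₃_ : Fin 3 → Fin 3 → Fin 3
i +₃ j = (toℕ i + toℕ j) mod 3

module LeftCosets {v : ℕ} (G : FinGroup v) (N : Subset v) (normal : IsNormalSubgroup G N) where
  open FinGroup G

  group : Group 0ℓ 0ℓ
  group = record { isGroup = isGroup }

  open Group group using (_\\_; assoc; identityˡ; identityʳ; inverseˡ)
  open import Algebra.Properties.Group group
    using (\\-leftDividesˡ; \\-leftDividesʳ; //-rightDividesʳ; ⁻¹-anti-homo-∙; ⁻¹-anti-homo-\\; ⁻¹-involutive; ε⁻¹≈ε)

  ε∈N : ε ∈ N
  ε∈N = proj₁ normal

  ∙-closed : ∀ x y → x ∈ N → y ∈ N → x ∙ y ∈ N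
  ∙-closed = proj₁ (proj₂ normal)

  ⁻¹-closed : ∀ x → x ∈ N → x ⁻¹ ∈ N
  ⁻¹-closed = proj₁ (proj₂ (proj₂ normal))

  conjugate-closed : ∀ g x → x ∈ N → g ∙ x ∙ g ⁻¹ ∈ N
  conjugate-closed = proj₂ (proj₂ (proj₂ normal))

  infix 4 _~_ _~?_

  _~_ : Fin v → Fin v → Set
  x ~ y = x \\ y ∈ N

  _~?_ : Decidable _~_
  x ~? y = x \\ y ∈? N

  ~-refl : ∀ {x} → x ~ x
  ~-refl {x} = subst (_∈ N) (sym (inverseˡ x)) ε∈N

  ~-sym : ∀ {x y} → x ~ y → y ~ x
  ~-sym {x} {y} x~y = subst (_∈ N) (⁻¹-anti-homo-\\ x y) (⁻¹-closed _ x~y)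

  ~-trans : ∀ {x y z} → x ~ y → y ~ z → x ~ z
  ~-trans {x} {y} {z} x~y y~z = subst (_∈ N) x\\y∙y\\z≡x\\z (∙-closed _ _ x~y y~z)
    where
    x\\y∙y\\z≡x\\z : (x \\ y) ∙ (y \\ z) ≡ x \\ z
    x\\y∙y\\z≡x\\z = trans (assoc (x ⁻¹) y (y \\ z)) (cong (x ⁻¹ ∙_) (\\-leftDividesˡ y z))

  ∙-\\-∙ : ∀ a b c → (a ∙ b) \\ (a ∙ c) ≡ b \\ c
  ∙-\\-∙ a b c = begin
    (a ∙ b) ⁻¹ ∙ (a ∙ c)     ≡⟨ cong (_∙ (a ∙ c)) (⁻¹-anti-homo-∙ a b) ⟩
    b ⁻¹ ∙ a ⁻¹ ∙ (a ∙ c)    ≡⟨ assoc (b ⁻¹) (a ⁻¹) (a ∙ c) ⟩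
    b ⁻¹ ∙ (a ⁻¹ ∙ (a ∙ c))  ≡⟨ cong (b ⁻¹ ∙_) (\\-leftDividesʳ a c) ⟩
    b ⁻¹ ∙ c                 ∎
    where open ≡-Reasoning

  ∙-congˡ-~ : ∀ {a b c} → b ~ c → a ∙ b ~ a ∙ c
  ∙-congˡ-~ {a} {b} {c} = subst (_∈ N) (sym (∙-\\-∙ a b c))

  ~-cancelˡ : ∀ {a b c} → a ∙ b ~ a ∙ c → b ~ c
  ~-cancelˡ {a} {b} {c} = subst (_∈ N) (∙-\\-∙ a b c)

  ∙-congʳ-~ : ∀ {x x′ y} → x ~ x′ → x ∙ y ~ x′ ∙ y
  ∙-congʳ-~ {x} {x′} {y} x~x′ = subst (_∈ N) conjugate≡ (conjugate-closed (y ⁻¹) _ x~x′)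
    where
    open ≡-Reasoning
    conjugate≡ : y ⁻¹ ∙ (x \\ x′) ∙ y ⁻¹ ⁻¹ ≡ (x ∙ y) \\ (x′ ∙ y)
    conjugate≡ = begin
      y ⁻¹ ∙ (x ⁻¹ ∙ x′) ∙ y ⁻¹ ⁻¹  ≡⟨ cong (y ⁻¹ ∙ (x ⁻¹ ∙ x′) ∙_) (⁻¹-involutive y) ⟩
      y ⁻¹ ∙ (x ⁻¹ ∙ x′) ∙ y        ≡⟨ cong (_∙ y) (assoc (y ⁻¹) (x ⁻¹) x′) ⟨
      y ⁻¹ ∙ x ⁻¹ ∙ x′ ∙ y          ≡⟨ assoc (y ⁻¹ ∙ x ⁻¹) x′ y ⟩
      y ⁻¹ ∙ x ⁻¹ ∙ (x′ ∙ y)        ≡⟨ cong (_∙ (x′ ∙ y)) (⁻¹-anti-homo-∙ x y) ⟨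
      (x ∙ y) ⁻¹ ∙ (x′ ∙ y)         ∎

  ~-cancelʳ : ∀ {x x′ y} → x ∙ y ~ x′ ∙ y → x ~ x′
  ~-cancelʳ {x} {x′} {y} xy~x′y =
    subst₂ _~_ (//-rightDividesʳ y x) (//-rightDividesʳ y x′) (∙-congʳ-~ {y = y ⁻¹} xy~x′y)

  ∙-cong-~ : ∀ {x x′ y y′} → x ~ x′ → y ~ y′ → x ∙ y ~ x′ ∙ y′
  ∙-cong-~ x~x′ y~y′ = ~-trans (∙-congʳ-~ x~x′) (∙-congˡ-~ y~y′)

  x~x∙y⇒ε~y : ∀ {x y} → x ~ x ∙ y → ε ~ y
  x~x∙y⇒ε~y {x} {y} p = ~-cancelˡ (subst (_~ x ∙ y) (sym (identityʳ x)) p)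

  y~x∙y⇒ε~x : ∀ {x y} → y ~ x ∙ y → ε ~ x
  y~x∙y⇒ε~x {x} {y} p = ~-cancelʳ (subst (_~ x ∙ y) (sym (identityˡ y)) p)

  x∈N⇔ε~x : ∀ {x} → x ∈ N ⇔ ε ~ x
  x∈N⇔ε~x {x} = mk⇔ (subst (_∈ N) (sym ε\\x≡x)) (subst (_∈ N) ε\\x≡x)
    where
    ε\\x≡x : ε \\ x ≡ x
    ε\\x≡x = trans (cong (_∙ x) ε⁻¹≈ε) (identityˡ x)

  ∑-coset : ∀ a → ∑[ x < v ] 𝟙 (a ~? x) ≡ ∣ N ∣
  ∑-coset a = sym (trans (∣p∣≡∑𝟙 N)
    (sum-permute (λ x → 𝟙 (x ∈? N)) (permutation (a \\_) (a ∙_) (\\-leftDividesʳ a) (\\-leftDividesˡ a))))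

  module IndexThree (index : 3 * ∣ N ∣ ≡ v) where

    instance
      ∣N∣-nonZero : NonZero ∣ N ∣
      ∣N∣-nonZero = >-nonZero (≤-trans (s≤s z≤n) (x∈p⇒∣p-x∣<∣p∣ ε∈N))

    two-cosets-miss : ∀ a b → ∃[ x ] ¬ (a ~ x ⊎ b ~ x)
    two-cosets-miss a b = ¬∀⟶∃¬ v _ (λ x → (a ~? x) ⊎-dec (b ~? x)) cover⇒⊥
      where
      open ≤-Reasoning
      cover⇒⊥ : ¬ (∀ x → a ~ x ⊎ b ~ x)
      cover⇒⊥ cover = <⇒≱ (*-monoˡ-< ∣ N ∣ {2} {3} ≤-refl) (begin
        3 * ∣ N ∣                                ≡⟨ index ⟩
        v                                        ≡⟨ ∑-const-1 v ⟨
        ∑[ x < v ] 1                             ≤⟨ ∑-mono-≤ (λ x → 𝟙-⊎ (a ~? x) (b ~? x) (cover x)) ⟩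
        ∑[ x < v ] (𝟙 (a ~? x) + 𝟙 (b ~? x))    ≡⟨ ∑-distrib-+ (λ x → 𝟙 (a ~? x)) (λ x → 𝟙 (b ~? x)) ⟩
        ∑[ x < v ] 𝟙 (a ~? x) + ∑[ x < v ] 𝟙 (b ~? x)
                                                 ≡⟨ cong₂ _+_ (∑-coset a) (trans (∑-coset b) (sym (+-identityʳ _))) ⟩
        2 * ∣ N ∣                                ∎)

    three-cosets-cover : ∀ {a b c} → ¬ a ~ b → ¬ a ~ c → ¬ b ~ c → ∀ x → a ~ x ⊎ b ~ x ⊎ c ~ x
    three-cosets-cover {a} {b} {c} a≁b a≁c b≁c x =
      𝟙₃≡1⇒⊎ (a ~? x) (b ~? x) (c ~? x) (∑-mono-≤-tight disjoint total x)
      where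
      open ≡-Reasoning
      disjoint : ∀ x → 𝟙 (a ~? x) + (𝟙 (b ~? x) + 𝟙 (c ~? x)) ≤ 1
      disjoint x = 𝟙-disjoint₃ (a ~? x) (b ~? x) (c ~? x)
        (λ a~x b~x → a≁b (~-trans a~x (~-sym b~x)))
        (λ a~x c~x → a≁c (~-trans a~x (~-sym c~x)))
        (λ b~x c~x → b≁c (~-trans b~x (~-sym c~x)))
      total : ∑[ x < v ] (𝟙 (a ~? x) + (𝟙 (b ~? x) + 𝟙 (c ~? x))) ≡ ∑[ x < v ] 1
      total = begin
        ∑[ x < v ] (𝟙 (a ~? x) + (𝟙 (b ~? x) + 𝟙 (c ~? x)))
          ≡⟨ ∑-distrib-+ (λ x → 𝟙 (a ~? x)) (λ x → 𝟙 (b ~? x) + 𝟙 (c ~? x)) ⟩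
        ∑[ x < v ] 𝟙 (a ~? x) + ∑[ x < v ] (𝟙 (b ~? x) + 𝟙 (c ~? x))
          ≡⟨ cong₂ _+_ refl (∑-distrib-+ (λ x → 𝟙 (b ~? x)) (λ x → 𝟙 (c ~? x))) ⟩
        ∑[ x < v ] 𝟙 (a ~? x) + (∑[ x < v ] 𝟙 (b ~? x) + ∑[ x < v ] 𝟙 (c ~? x))
          ≡⟨ cong₂ _+_ (∑-coset a) (cong₂ _+_ (∑-coset b) (trans (∑-coset c) (sym (+-identityʳ _)))) ⟩
        3 * ∣ N ∣
          ≡⟨ trans index (sym (∑-const-1 v)) ⟩
        ∑[ x < v ] 1 ∎

    coset-representatives : ∃[ g ] ∃[ h ] (¬ ε ~ g × ¬ ε ~ h × ¬ g ~ h)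
    coset-representatives with two-cosets-miss ε ε
    ... | g , g∉ε∪ε with two-cosets-miss ε g
    ...   | h , h∉ε∪g = g , h , g∉ε∪ε ∘ inj₁ , h∉ε∪g ∘ inj₁ , h∉ε∪g ∘ inj₂

  module QuotientByThreeCosets {g h : Fin v} (ε≁g : ¬ ε ~ g) (ε≁h : ¬ ε ~ h) (g≁h : ¬ g ~ h)
                                 (cover : ∀ x → ε ~ x ⊎ g ~ x ⊎ h ~ x) where

    rep : Fin 3 → Fin v
    rep 0F = ε
    rep 1F = g
    rep 2F = h

    rep-injective : ∀ i j → rep i ~ rep j → i ≡ j
    rep-injective 0F 0F _   = refl
    rep-injective 1F 1F _   = refl
    rep-injective 2F 2F _   = refl
    rep-injective 0F 1F ε~g = contradiction ε~g ε≁g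
    rep-injective 0F 2F ε~h = contradiction ε~h ε≁h
    rep-injective 1F 2F g~h = contradiction g~h g≁h
    rep-injective 1F 0F g~ε = contradiction (~-sym g~ε) ε≁g
    rep-injective 2F 0F h~ε = contradiction (~-sym h~ε) ε≁h
    rep-injective 2F 1F h~g = contradiction (~-sym h~g) g≁h

    coset-of : ∀ x → Σ (Fin 3) (λ i → rep i ~ x)
    coset-of x with cover x
    ... | inj₁ ε~x        = 0F , ε~x
    ... | inj₂ (inj₁ g~x) = 1F , g~x
    ... | inj₂ (inj₂ h~x) = 2F , h~x

    class : Fin v → Fin 3
    class x = proj₁ (coset-of x)

    rep-class : ∀ x → rep (class x) ~ x
    rep-class x = proj₂ (coset-of x)

    class-unique : ∀ {i x} → rep i ~ x → class x ≡ i
    class-unique {i} {x} i~x = rep-injective (class x) i (~-trans (rep-class x) (~-sym i~x))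

    𝟙-class : ∀ x i → 𝟙 (class x ≟ i) ≡ 𝟙 (rep i ~? x)
    𝟙-class x i = 𝟙-⇔ (mk⇔ (λ { refl → rep-class x }) class-unique) (class x ≟ i) (rep i ~? x)

    ε~g∙h : ε ~ g ∙ h
    ε~g∙h with coset-of (g ∙ h)
    ... | 0F , ε~gh = ε~gh
    ... | 1F , g~gh = contradiction (x~x∙y⇒ε~y g~gh) ε≁h
    ... | 2F , h~gh = contradiction (y~x∙y⇒ε~x h~gh) ε≁g

    ε~h∙g : ε ~ h ∙ g
    ε~h∙g with coset-of (h ∙ g)
    ... | 0F , ε~hg = ε~hg
    ... | 1F , g~hg = contradiction (y~x∙y⇒ε~x g~hg) ε≁h
    ... | 2F , h~hg = contradiction (x~x∙y⇒ε~y h~hg) ε≁g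

    h~g∙g : h ~ g ∙ g
    h~g∙g with coset-of (g ∙ g)
    ... | 0F , ε~gg = contradiction (~-cancelˡ (~-trans (~-sym ε~gg) ε~g∙h)) g≁h
    ... | 1F , g~gg = contradiction (x~x∙y⇒ε~y g~gg) ε≁g
    ... | 2F , h~gg = h~gg

    g~h∙h : g ~ h ∙ h
    g~h∙h with coset-of (h ∙ h)
    ... | 0F , ε~hh = contradiction (~-sym (~-cancelˡ (~-trans (~-sym ε~hh) ε~h∙g))) g≁h
    ... | 1F , g~hh = g~hh
    ... | 2F , h~hh = contradiction (x~x∙y⇒ε~y h~hh) ε≁h

    rep-+₃ : ∀ i j → rep (i +₃ j) ~ rep i ∙ rep j
    rep-+₃ 0F 0F = subst (ε ~_) (sym (identityˡ ε)) ~-refl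
    rep-+₃ 0F 1F = subst (g ~_) (sym (identityˡ g)) ~-refl
    rep-+₃ 0F 2F = subst (h ~_) (sym (identityˡ h)) ~-refl
    rep-+₃ 1F 0F = subst (g ~_) (sym (identityʳ g)) ~-refl
    rep-+₃ 2F 0F = subst (h ~_) (sym (identityʳ h)) ~-refl
    rep-+₃ 1F 1F = h~g∙g
    rep-+₃ 1F 2F = ε~g∙h
    rep-+₃ 2F 1F = ε~h∙g
    rep-+₃ 2F 2F = g~h∙h

    class-∙ : ∀ x y → class (x ∙ y) ≡ class x +₃ class y
    class-∙ x y = class-unique (~-trans (rep-+₃ (class x) (class y)) (∙-cong-~ (rep-class x) (rep-class y)))

    class-ε : class ε ≡ 0F
    class-ε = class-unique ~-refl

    ∑-class : ∀ t → ∑[ a < v ] 𝟙 (class a ≟ t) ≡ ∣ N ∣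
    ∑-class t = trans (sum-cong-≗ (λ a → 𝟙-class a t)) (∑-coset (rep t))

    ∣S∩coset∣ : ∀ S i → ∣ S ∩ coset G (rep i) N ∣ ≡ ∣S∩fibre∣ G S class i
    ∣S∩coset∣ S i = trans (∣p∩q∣≡∑𝟙*𝟙 S (coset G (rep i) N)) (sum-cong-≗ λ x →
      cong (𝟙 (x ∈? S) *_) (trans (𝟙-∈-tabulate (rep i ~?_) x) (sym (𝟙-class x i))))

    ∣S∣≡∑∣S∩coset∣ : ∀ S → ∣ S ∣ ≡ ∣S∩fibre∣ G S class 0F + (∣S∩fibre∣ G S class 1F + ∣S∩fibre∣ G S class 2F)
    ∣S∣≡∑∣S∩coset∣ S = trans (∣p∣≡∑𝟙 S) (trans (∑-fibre-weight class (λ x → 𝟙 (x ∈? S)))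
      (cong (λ z → ∣S∩fibre∣ G S class 0F + (∣S∩fibre∣ G S class 1F + z)) (+-identityʳ (∣S∩fibre∣ G S class 2F))))

    ∣S∩N∣ : ∀ S → ∣ S ∩ N ∣ ≡ ∣S∩fibre∣ G S class 0F
    ∣S∩N∣ S = trans (∣p∩q∣≡∑𝟙*𝟙 S N) (sum-cong-≗ λ x →
      cong (𝟙 (x ∈? S) *_) (trans (𝟙-⇔ x∈N⇔ε~x (x ∈? N) (ε ~? x)) (sym (𝟙-class x 0F))))

    pairs-over-class : ∀ {S μ} → (∀ a → a ≢ ε → reps G S a ≡ μ) → ∀ t → t ≢ 0F →
      ∑[ i < 3 ] ∑[ j < 3 ] (∣S∩fibre∣ G S class i * ∣S∩fibre∣ G S class j * 𝟙 (i +₃ j ≟ t)) ≡ μ * ∣ N ∣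
    pairs-over-class {S} {μ} reps≡μ t t≢0 = begin
      ∑[ i < 3 ] ∑[ j < 3 ] (∣S∩fibre∣ G S class i * ∣S∩fibre∣ G S class j * 𝟙 (i +₃ j ≟ t))
        ≡⟨ reps-over-fibre G S class _+₃_ class-∙ t ⟨
      ∑[ a < v ] (reps G S a * 𝟙 (class a ≟ t))
        ≡⟨ ∑-*𝟙-const (λ a → class a ≟ t) (reps G S) reps≡μ-over-t ⟩
      μ * ∑[ a < v ] 𝟙 (class a ≟ t)
        ≡⟨ cong (μ *_) (∑-class t) ⟩
      μ * ∣ N ∣ ∎
      where
      open ≡-Reasoning
      reps≡μ-over-t : ∀ a → class a ≡ t → reps G S a ≡ μ
      reps≡μ-over-t a class≡t = reps≡μ a (λ { refl → t≢0 (trans (sym class≡t) class-ε) })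

-- The left-hand side of table is what the double sum over Fin 3 computes to: its 0/1 factors are
-- the addition table of ℤ/3ℤ.
convolution₃-1 : ∀ (A : Fin 3 → ℕ) →
  ∑[ i < 3 ] ∑[ j < 3 ] (A i * A j * 𝟙 (i +₃ j ≟ 1F)) ≡ A 0F * A 1F + (A 1F * A 0F + A 2F * A 2F)
convolution₃-1 A = table (A 0F) (A 1F) (A 2F)
  where
  table : ∀ a b c →
    (a * a * 0 + (a * b * 1 + (a * c * 0 + 0))) +
    ((b * a * 1 + (b * b * 0 + (b * c * 0 + 0))) +
    ((c * a * 0 + (c * b * 0 + (c * c * 1 + 0))) + 0)) ≡ a * b + (b * a + c * c)
  table = solve-∀

convolution₃-2 : ∀ (A : Fin 3 → ℕ) →
  ∑[ i < 3 ] ∑[ j < 3 ] (A i * A j * 𝟙 (i +₃ j ≟ 2F)) ≡ A 0F * A 2F + (A 2F * A 0F + A 1F * A 1F)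
convolution₃-2 A = table (A 0F) (A 1F) (A 2F)
  where
  table : ∀ a b c →
    (a * a * 0 + (a * b * 0 + (a * c * 1 + 0))) +
    ((b * a * 0 + (b * b * 1 + (b * c * 0 + 0))) +
    ((c * a * 1 + (c * b * 0 + (c * c * 0 + 0))) + 0)) ≡ a * c + (c * a + b * b)
  table = solve-∀

pos-ab+ba+cc : ∀ a b c → + (a * b + (b * a + c * c)) ≡ + a ℤ.* + b ℤ.+ (+ b ℤ.* + a ℤ.+ + c ℤ.* + c)
pos-ab+ba+cc a b c = trans (pos-+ (a * b) (b * a + c * c))
  (cong₂ ℤ._+_ (pos-* a b) (trans (pos-+ (b * a) (c * c)) (cong₂ ℤ._+_ (pos-* b a) (pos-* c c))))

balanced : ∀ a b c → a * b + (b * a + c * c) ≡ a * c + (c * a + b * b) → b ≢ c → b + c ≡ a + a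
balanced a b c eq b≢c =
  [ (λ B-C≡0 → contradiction (+-injective (i-j≡0⇒i≡j B C B-C≡0)) b≢c)
  , (λ D≡0 → +-injective (trans (pos-+ b c) (trans (i-j≡0⇒i≡j (B ℤ.+ C) (A ℤ.+ A) D≡0) (sym (pos-+ a a)))))
  ]′ (i*j≡0⇒i≡0∨j≡0 (B - C) product≡0)
  where
  open ≡-Reasoning
  A B C : ℤ
  A = + a
  B = + b
  C = + c
  factorisation : ∀ A B C → (B - C) ℤ.* ((B ℤ.+ C) - (A ℤ.+ A))
                  ≡ (A ℤ.* C ℤ.+ (C ℤ.* A ℤ.+ B ℤ.* B)) - (A ℤ.* B ℤ.+ (B ℤ.* A ℤ.+ C ℤ.* C))
  factorisation = ℤ-Solver.solve-∀
  product≡0 : (B - C) ℤ.* ((B ℤ.+ C) - (A ℤ.+ A)) ≡ + 0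
  product≡0 = begin
    (B - C) ℤ.* ((B ℤ.+ C) - (A ℤ.+ A))
      ≡⟨ factorisation A B C ⟩
    (A ℤ.* C ℤ.+ (C ℤ.* A ℤ.+ B ℤ.* B)) - (A ℤ.* B ℤ.+ (B ℤ.* A ℤ.+ C ℤ.* C))
      ≡⟨ cong₂ _-_ (pos-ab+ba+cc a c b) (pos-ab+ba+cc a b c) ⟨
    + (a * c + (c * a + b * b)) - + (a * b + (b * a + c * c))
      ≡⟨ i≡j⇒i-j≡0 (cong +_ (sym eq)) ⟩
    + 0 ∎

k²-μv≡-3[a-c]² : ∀ {k μ m v} a b c → a * b + (b * a + c * c) ≡ μ * m → b + c ≡ a + a →
                 k ≡ a + (b + c) → 3 * m ≡ v →
                 + (k * k) - + (μ * v) ≡ - (+ 3 ℤ.* ((+ a - + c) ℤ.* (+ a - + c)))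
k²-μv≡-3[a-c]² {k} {μ} {m} {v} a b c pairs b+c≡a+a k≡a+b+c 3m≡v = begin
  + (k * k) - + (μ * v)
    ≡⟨ cong₂ _-_ (trans (pos-* k k) (cong₂ ℤ._*_ pos-k pos-k))
                 (trans (cong +_ μv≡3*pairs) (trans (pos-* 3 (a * b + (b * a + c * c))) (cong₂ ℤ._*_ (refl {x = + 3}) (pos-ab+ba+cc a b c)))) ⟩
  (A ℤ.+ (B ℤ.+ C)) ℤ.* (A ℤ.+ (B ℤ.+ C)) - + 3 ℤ.* (A ℤ.* B ℤ.+ (B ℤ.* A ℤ.+ C ℤ.* C))
    ≡⟨ square-identity A B C ⟩
  - (+ 3 ℤ.* ((A - C) ℤ.* (A - C))) ℤ.+ D ℤ.* D
    ≡⟨ cong (λ d → - (+ 3 ℤ.* ((A - C) ℤ.* (A - C))) ℤ.+ d ℤ.* d) D≡0 ⟩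
  - (+ 3 ℤ.* ((A - C) ℤ.* (A - C))) ℤ.+ + 0
    ≡⟨ ℤ-+-identityʳ _ ⟩
  - (+ 3 ℤ.* ((A - C) ℤ.* (A - C))) ∎
  where
  open ≡-Reasoning
  A B C D : ℤ
  A = + a
  B = + b
  C = + c
  D = (B ℤ.+ C) - (A ℤ.+ A)
  square-identity : ∀ A B C →
    (A ℤ.+ (B ℤ.+ C)) ℤ.* (A ℤ.+ (B ℤ.+ C)) - + 3 ℤ.* (A ℤ.* B ℤ.+ (B ℤ.* A ℤ.+ C ℤ.* C))
    ≡ - (+ 3 ℤ.* ((A - C) ℤ.* (A - C))) ℤ.+ ((B ℤ.+ C) - (A ℤ.+ A)) ℤ.* ((B ℤ.+ C) - (A ℤ.+ A))
  square-identity = ℤ-Solver.solve-∀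
  D≡0 : D ≡ + 0
  D≡0 = i≡j⇒i-j≡0 (trans (sym (pos-+ b c)) (trans (cong +_ b+c≡a+a) (pos-+ a a)))
  pos-k : + k ≡ A ℤ.+ (B ℤ.+ C)
  pos-k = trans (cong +_ k≡a+b+c) (trans (pos-+ a (b + c)) (cong₂ ℤ._+_ (refl {x = A}) (pos-+ b c)))
  μv≡3*pairs : μ * v ≡ 3 * (a * b + (b * a + c * c))
  μv≡3*pairs = begin
    μ * v        ≡⟨ cong (μ *_) 3m≡v ⟨
    μ * (3 * m)  ≡⟨ *-comm μ (3 * m) ⟩
    3 * m * μ    ≡⟨ *-assoc 3 m μ ⟩
    3 * (m * μ)  ≡⟨ cong (3 *_) (trans (*-comm m μ) (sym pairs)) ⟩
    3 * (a * b + (b * a + c * c)) ∎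

index-three-arithmetic :
  ∀ {k μ m v} a b c → a * b + (b * a + c * c) ≡ μ * m → a * c + (c * a + b * b) ≡ μ * m → b ≢ c →
  k ≡ a + (b + c) → 3 * m ≡ v →
  (3 ∣ k) × (a ≡ k / 3) × Σ ℤ (λ x → ¬ (x ≡ + 0) × (+ (k * k) - + (μ * v) ≡ - (+ 3 ℤ.* (x ℤ.* x))))
index-three-arithmetic {k} {μ} {m} {v} a b c pairs₁ pairs₂ b≢c k≡a+b+c 3m≡v =
  divides a k≡a*3 , a≡k/3 , + a - + c , a-c≢0 , k²-μv≡-3[a-c]² {k} {μ} {m} {v} a b c pairs₁ b+c≡a+a k≡a+b+c 3m≡v
  where
  open ≡-Reasoning
  b+c≡a+a : b + c ≡ a + a
  b+c≡a+a = balanced a b c (trans pairs₁ (sym pairs₂)) b≢c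
  k≡a*3 : k ≡ a * 3
  k≡a*3 = begin
    k            ≡⟨ k≡a+b+c ⟩
    a + (b + c)  ≡⟨ cong (λ z → a + z) b+c≡a+a ⟩
    a + (a + a)  ≡⟨ cong (λ z → a + (a + z)) (+-identityʳ a) ⟨
    3 * a        ≡⟨ *-comm 3 a ⟩
    a * 3        ∎
  a≡k/3 : a ≡ k / 3
  a≡k/3 = sym (trans (cong (_/ 3) k≡a*3) (m*n/n≡m a 3))
  a-c≢0 : + a - + c ≢ + 0
  a-c≢0 a-c≡0 = b≢c (+-cancelʳ-≡ c b c (trans b+c≡a+a (cong (λ z → z + z) a≡c)))
    where
    a≡c : a ≡ c
    a≡c = +-injective (i-j≡0⇒i≡j (+ a) (+ c) a-c≡0)

theorem3p6 : (v k μ : ℕ) (G : FinGroup v) (S N : Subset v) →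
    IsSumSet G S k μ →
    IsNormalSubgroup G N →
    3 * ∣ N ∣ ≡ v →
    (∀ g h → (FinGroup._∙_ G (FinGroup._⁻¹ G g) h) ∉ N →
      ¬ (∣ S ∩ coset G g N ∣ ≡ ∣ S ∩ coset G h N ∣)) →
    (3 ∣ k) × (∣ S ∩ N ∣ ≡ k / 3) ×
    Σ ℤ (λ x → ¬ (x ≡ + 0) ×
      ((+ (k * k)) - (+ (μ * v)) ≡ - ((+ 3) ℤ.* (x ℤ.* x))))
theorem3p6 v k μ G S N (∣S∣≡k , reps≡μ) normal index distinct
  with LeftCosets.IndexThree.coset-representatives G N normal index
... | g , h , ε≁g , ε≁h , g≁h =
  subst (λ a → (3 ∣ k) × (a ≡ k / 3) × _) (sym (∣S∩N∣ S))
    (index-three-arithmetic {k} {μ} {∣ N ∣} {v} (A 0F) (A 1F) (A 2F)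
      (trans (sym (convolution₃-1 A)) (pairs-over-class reps≡μ 1F (λ ())))
      (trans (sym (convolution₃-2 A)) (pairs-over-class reps≡μ 2F (λ ())))
      (λ A₁≡A₂ → distinct g h g≁h (trans (∣S∩coset∣ S 1F) (trans A₁≡A₂ (sym (∣S∩coset∣ S 2F)))))
      (trans (sym ∣S∣≡k) (∣S∣≡∑∣S∩coset∣ S))
      index)
  where
  open LeftCosets G N normal
  open QuotientByThreeCosets ε≁g ε≁h g≁h (IndexThree.three-cosets-cover index ε≁g ε≁h g≁h)

  A : Fin 3 → ℕ
  A = ∣S∩fibre∣ G S class
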